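{- Let $D=(F,T)\in\mathcal D_k$, let $G$ be a graph with $G\sqsubseteq_{\mathrm{col}} D$, and let $f:D\twoheadrightarrow G$ be a shrinking epimorphism from $D$ to $G$. Then $V(G)$ has a unique $\preceq^T$-minimal element, so $T$ induces a subtree $T[V(G)]$ on $V(G)$, and this subtree is an elimination tree of $G$ of height at most $k$, i.e. $(G,T[V(G)])\in\mathcal D_k$.
   Context: Graphs are finite, undirected, vertex-coloured triples $(V(G),E(G),\gamma^G)$ with $E(G)\subseteq\binom{V(G)}{2}$ and $\gamma^G$ a colouring of the vertices. A homomorphism $h:F\to G$ maps $V(F)\to V(G)$, preserves edges and colours. It is an epimorphism if it is surjective and every edge $vv'\in E(G)$ equals $h(u)h(u')$ for some edge $uu'\in E(F)$. A forest is a finite set with partial order $\preceq$ such that every set $\{u:u\preceq t\}$ is a chain; a tree is a forest with a unique minimal element (the root). Height = maximum number of elements in a chain. For a tree $T$ and $U\subseteq V(T)$ with a unique $\preceq^T$-minimal element, $T[U]$ denotes the tree on $U$ with the restricted order. An elimination tree of a graph $F$ is a tree on $V(F)$ such that for each edge $uv$, $u\preceq v$ or $v\preceq u$. $\mathcal D_k$ is the class of pairs $D=(F,T)$ with $F$ a graph (not necessarily connected) and $T$ an elimination tree of $F$ of height at most $k$; write $V(D)=V(F)$, $\preceq^D=\preceq^T$, and a homomorphism from $D$ is a homomorphism from $F$. $G\sqsubseteq_{\mathrm{col}} D$ means $V(G)\subseteq V(F)$ and $\gamma^G(v)=\gamma^F(v)$ for all $v\in V(G)$ (no condition on edges). A shrinking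 homomorphism from $D$ to a graph $G$ with $V(G)\subseteq V(D)$ is a homomorphism $h:F\to G$ with $h(u)\preceq^D u$ for all $u$ and $h(h(u))=h(u)$ for all $u$; a shrinking epimorphism is a shrinking homomorphism that is an epimorphism. -}

module Defs where

open import Data.Nat using (ℕ; _≤_)
open import Data.Fin using (Fin)
open import Data.Fin.Subset using (Subset; _∈_)
open import Data.List using (List; length)
open import Data.List.Relation.Unary.All using (All)
open import Data.List.Relation.Unary.AllPairs using (AllPairs)
open import Data.List.Relation.Unary.Unique.Propositional using (Unique)
open import Data.Product using (Σ; _×_; ∃)
open import Data.Sum using (_⊎_)
open import Relation.Nullary using (¬_)
open import Relation.Binary.PropositionalEquality using (_≡_)

-- Vertex names are drawn from Fin n; a graph has a vertex set V ⊆ Fin n,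
-- a symmetric irreflexive edge relation on V, and a vertex colouring γ
-- (only its values on V matter).
record Graph (n : ℕ) (C : Set) : Set₁ where
  field
    V     : Subset n
    E     : Fin n → Fin n → Set
    E⊆V   : ∀ {u v} → E u v → u ∈ V × v ∈ V
    E-sym : ∀ {u v} → E u v → E v u
    E-irr : ∀ {u} → ¬ E u u
    γ     : Fin n → C
open Graph public

module _ {n : ℕ} (P : Subset n) (_≼_ : Fin n → Fin n → Set) where

  Minimal : Fin n → Set
  Minimal m = m ∈ P × (∀ v → v ∈ P → v ≼ m → v ≡ m)

  HasUniqueMinimal : Set
  HasUniqueMinimal = Σ (Fin n) λ r → Minimal r × (∀ m → Minimal m → m ≡ r)

  record IsTree : Set where
    field
      ≼-refl    : ∀ {u} → u ∈ P → u ≼ u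
      ≼-antisym : ∀ {u v} → u ∈ P → v ∈ P → u ≼ v → v ≼ u → u ≡ v
      ≼-trans   : ∀ {u v w} → u ∈ P → v ∈ P → w ∈ P → u ≼ v → v ≼ w → u ≼ w
      downChain : ∀ {t u v} → t ∈ P → u ∈ P → v ∈ P → u ≼ t → v ≼ t
                  → u ≼ v ⊎ v ≼ u
      root      : HasUniqueMinimal

  Comparable : Fin n → Fin n → Set
  Comparable u v = u ≼ v ⊎ v ≼ u

  HeightAtMost : ℕ → Set
  HeightAtMost k = (xs : List (Fin n)) → All (_∈ P) xs → Unique xs
                   → AllPairs Comparable xs → length xs ≤ k

IsElimTree : ∀ {n C} → Graph n C → (Fin n → Fin n → Set) → Set
IsElimTree G _≼_ = IsTree (V G) _≼_ × (∀ {u v} → E G u v → u ≼ v ⊎ v ≼ u)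

InD : ∀ {n C} → ℕ → Graph n C → (Fin n → Fin n → Set) → Set
InD k G _≼_ = IsElimTree G _≼_ × HeightAtMost (V G) _≼_ k

_⊑col_ : ∀ {n C} → Graph n C → Graph n C → Set
G ⊑col F = ∀ v → v ∈ V G → v ∈ V F × γ G v ≡ γ F v

record IsHom {n C} (F G : Graph n C) (h : Fin n → Fin n) : Set where
  field
    maps     : ∀ u → u ∈ V F → h u ∈ V G
    edges    : ∀ {u u'} → E F u u' → E G (h u) (h u')
    colours  : ∀ u → u ∈ V F → γ G (h u) ≡ γ F u

record IsEpi {n C} (F G : Graph n C) (h : Fin n → Fin n) : Set where
  field
    hom        : IsHom F G h
    surjective : ∀ v → v ∈ V G → ∃ λ u → u ∈ V F × h u ≡ v
    edgeSurj   : ∀ {v v'} → E G v v' →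
                 ∃ λ u → ∃ λ u' → E F u u' × h u ≡ v × h u' ≡ v'

record IsShrinkingEpi {n C} (F : Graph n C) (_≼_ : Fin n → Fin n → Set)
                      (G : Graph n C) (h : Fin n → Fin n) : Set where
  field
    epi        : IsEpi F G h
    shrinks    : ∀ u → u ∈ V F → h u ≼ u
    idempotent : ∀ u → u ∈ V F → h (h u) ≡ h u

-- In a tree of bounded height every element lies above the root: walking strictly
-- downwards from an element builds a chain, which must stop within k steps, and it
-- can only stop at a minimal element, i.e. at the root. (Since ≼ is not decidable
-- this holds only up to double negation, which suffices because equality of
-- vertices is decidable.) The shrinking map fixes the root r of T, so r ∈ V(G) is
-- the unique minimal element of V(G). An edge of G is the image f u f v of an edge
-- u v of F; as f u ≼ u and f v ≼ v, both images lie below the larger of u and v,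
-- so they are comparable.
module Submission where

open import Defs
open import Data.Nat using (ℕ; zero; suc; s≤s; _≤_; _+_)
open import Data.Nat.Properties using (≤-refl; ≤⇒≯; +-identityʳ; +-suc)
open import Data.Fin using (Fin; _≟_)
open import Data.Fin.Subset using (Subset; _∈_; _⊆_)
open import Data.List using (_∷_; length)
open import Data.List.Relation.Unary.All as All using (All; []; _∷_)
open import Data.List.Relation.Unary.AllPairs as AllPairs using (AllPairs)
open import Data.List.Relation.Unary.Linked using (Linked; [-]; _∷_)
open import Data.List.Relation.Unary.Linked.Properties using (Linked⇒AllPairs)
open import Data.Product using (_×_; _,_; proj₁; proj₂; ∃)
open import Data.Sum using (_⊎_; inj₁; inj₂)
open import Function using (_∘_)
open import Relation.Nullary using (¬_)
open import Relation.Nullary.Decidable using (decidable-stable)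
open import Relation.Binary.Definitions using (Transitive)
open import Relation.Binary.PropositionalEquality using (_≡_; _≢_; refl; sym; subst)

module _ {n : ℕ} {P Q : Subset n} {_≼_ : Fin n → Fin n → Set} (Q⊆P : Q ⊆ P) where

  IsTree-⊆ : IsTree P _≼_ → HasUniqueMinimal Q _≼_ → IsTree Q _≼_
  IsTree-⊆ T rootQ = record
    { ≼-refl    = ≼-refl ∘ Q⊆P
    ; ≼-antisym = λ u v → ≼-antisym (Q⊆P u) (Q⊆P v)
    ; ≼-trans   = λ u v w → ≼-trans (Q⊆P u) (Q⊆P v) (Q⊆P w)
    ; downChain = λ t u v → downChain (Q⊆P t) (Q⊆P u) (Q⊆P v)
    ; root      = rootQ
    }
    where open IsTree T

  HeightAtMost-⊆ : ∀ {k} → HeightAtMost P _≼_ k → HeightAtMost Q _≼_ k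
  HeightAtMost-⊆ height xs xs⊆Q = height xs (All.map Q⊆P xs⊆Q)

module Tree {n : ℕ} {P : Subset n} {_≼_ : Fin n → Fin n → Set} (T : IsTree P _≼_) where
  open IsTree T

  r : Fin n
  r = proj₁ root

  r-minimal : Minimal P _≼_ r
  r-minimal = proj₁ (proj₂ root)

  r∈P : r ∈ P
  r∈P = proj₁ r-minimal

  minimal⇒r≼ : ∀ {u} → Minimal P _≼_ u → r ≼ u
  minimal⇒r≼ u-minimal = subst (r ≼_) (sym (proj₂ (proj₂ root) _ u-minimal)) (≼-refl r∈P)

  Comparable-shrink : ∀ {u v u′ v′} → u ∈ P → v ∈ P → u′ ∈ P → v′ ∈ P →
                      u′ ≼ u → v′ ≼ v → Comparable P _≼_ u v → Comparable P _≼_ u′ v′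
  Comparable-shrink uP vP u′P v′P u′≼u v′≼v (inj₁ u≼v) =
    downChain vP u′P v′P (≼-trans u′P uP vP u′≼u u≼v) v′≼v
  Comparable-shrink uP vP u′P v′P u′≼u v′≼v (inj₂ v≼u) =
    downChain uP u′P v′P u′≼u (≼-trans v′P vP uP v′≼v v≼u)

  _≺_ : Fin n → Fin n → Set
  u ≺ v = u ∈ P × v ∈ P × u ≼ v × u ≢ v

  ≺-trans : Transitive _≺_
  ≺-trans (uP , vP , u≼v , u≢v) (_ , wP , v≼w , v≢w) =
    uP , wP , ≼-trans uP vP wP u≼v v≼w ,
    λ { refl → u≢v (≼-antisym uP vP u≼v v≼w) }

  ¬minimal⇒¬¬∃≺ : ∀ {u} → u ∈ P → ¬ Minimal P _≼_ u → ¬ ¬ ∃ (_≺ u)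
  ¬minimal⇒¬¬∃≺ {u} uP ¬u-minimal ¬∃≺u = ¬u-minimal (uP , below⇒≡)
    where
    below⇒≡ : ∀ v → v ∈ P → v ≼ u → v ≡ u
    below⇒≡ v vP v≼u = decidable-stable (v ≟ u) (λ v≢u → ¬∃≺u (v , vP , uP , v≼u , v≢u))

  module Height {k : ℕ} (height : HeightAtMost P _≼_ k) where

    strictChain-length≤ : ∀ {u xs} → u ∈ P → Linked _≺_ (u ∷ xs) → length (u ∷ xs) ≤ k
    strictChain-length≤ {u} {xs} uP chain =
      height (u ∷ xs) (chain⊆P uP chain) (AllPairs.map (proj₂ ∘ proj₂ ∘ proj₂) pairs)
             (AllPairs.map (inj₁ ∘ proj₁ ∘ proj₂ ∘ proj₂) pairs)
      where
      pairs : AllPairs _≺_ (u ∷ xs)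
      pairs = Linked⇒AllPairs ≺-trans chain
      chain⊆P : ∀ {u xs} → u ∈ P → Linked _≺_ (u ∷ xs) → All (_∈ P) (u ∷ xs)
      chain⊆P uP [-]                     = uP ∷ []
      chain⊆P uP ((_ , xP , _) ∷ chain) = uP ∷ chain⊆P xP chain

    -- s bounds the number of further steps down the chain u ∷ xs.
    ¬¬r≼-below-chain : ∀ s {u xs} → u ∈ P → Linked _≺_ (u ∷ xs) → k ≤ length xs + s → ¬ ¬ (r ≼ u)
    ¬¬r≼-below-chain zero uP chain k≤ _ =
      ≤⇒≯ (strictChain-length≤ uP chain) (s≤s (subst (k ≤_) (+-identityʳ _) k≤))
    ¬¬r≼-below-chain (suc s) {u} {xs} uP chain k≤ r⋠u =
      ¬minimal⇒¬¬∃≺ uP (r⋠u ∘ minimal⇒r≼) λ { (w , w≺u@(wP , _ , w≼u , _)) →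
        ¬¬r≼-below-chain s wP (w≺u ∷ chain) (subst (k ≤_) (+-suc (length xs) s) k≤)
          (λ r≼w → r⋠u (≼-trans r∈P wP uP r≼w w≼u)) }

    ¬¬r≼ : ∀ {u} → u ∈ P → ¬ ¬ (r ≼ u)
    ¬¬r≼ uP = ¬¬r≼-below-chain k uP [-] ≤-refl

    HasUniqueMinimal-⊆ : ∀ {Q} → Q ⊆ P → r ∈ Q → HasUniqueMinimal Q _≼_
    HasUniqueMinimal-⊆ {Q} Q⊆P r∈Q =
      r , (r∈Q , λ v v∈Q → proj₂ r-minimal v (Q⊆P v∈Q)) , minimal⇒≡r
      where
      minimal⇒≡r : ∀ m → Minimal Q _≼_ m → m ≡ r
      minimal⇒≡r m (m∈Q , m-minimal) = decidable-stable (m ≟ r) λ m≢r →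
        ¬¬r≼ (Q⊆P m∈Q) (λ r≼m → m≢r (sym (m-minimal r r∈Q r≼m)))

lemma6 : {n : ℕ} {C : Set} (k : ℕ) (F : Graph n C) (_≼_ : Fin n → Fin n → Set)
         → InD k F _≼_
         → (G : Graph n C) → G ⊑col F
         → (f : Fin n → Fin n) → IsShrinkingEpi F _≼_ G f
         → HasUniqueMinimal (V G) _≼_ × InD k G _≼_
lemma6 k F _≼_ ((T , elimF) , height) G G⊑F f shrinking =
  rootG , (IsTree-⊆ VG⊆VF T rootG , elimG) , HeightAtMost-⊆ VG⊆VF height
  where
  open IsShrinkingEpi shrinking
  open IsEpi epi
  open IsHom hom
  open Tree T
  open Height height

  VG⊆VF : V G ⊆ V F
  VG⊆VF = proj₁ ∘ G⊑F _

  f∈VF : ∀ {u} → u ∈ V F → f u ∈ V F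
  f∈VF uP = VG⊆VF (maps _ uP)

  r∈VG : r ∈ V G
  r∈VG = subst (_∈ V G) (proj₂ r-minimal (f r) (f∈VF r∈P) (shrinks r r∈P)) (maps r r∈P)

  rootG : HasUniqueMinimal (V G) _≼_
  rootG = HasUniqueMinimal-⊆ VG⊆VF r∈VG

  elimG : ∀ {u v} → E G u v → u ≼ v ⊎ v ≼ u
  elimG e with edgeSurj e
  ... | u , v , e′ , refl , refl with E⊆V F e′
  ... | uP , vP = Comparable-shrink uP vP (f∈VF uP) (f∈VF vP) (shrinks u uP) (shrinks v vP) (elimF e′)
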